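{- Let $(\mathcal{G},\mathcal{I})$ be a $k$-exchange system, $f:2^{\mathcal{G}}\to\mathbb{R}_{+}$ monotone submodular, $\alpha>0$ the rounding unit, $S\in\mathcal{I}$ a current solution with total order $\prec$ on $\mathcal{G}$, and $w_S$ the weight function of $S$ with respect to $\prec$. Suppose that for some $k$-replacement $(A,B)$ and some real $\gamma>0$ we have $\sum_{a\in A}w_{(A,B)}(a)^2\ge\sum_{b\in B}w_S(b)^2+\gamma$, and the algorithm applies $(A,B)$, producing $T=(S\setminus B)\cup A$ and the updated order $\prec_T$ (every element of $S\setminus B$ precedes every element of $A$; all other pairs ordered as in $\prec$). Let $w_T$ be the weight function of $T$ with respect to $\prec_T$. Then $\sum_{t\in T}w_T(t)^2\ge\sum_{s\in S}w_S(s)^2+\gamma$.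
   Context: A $k$-exchange system is an independence system $(\mathcal{G},\mathcal{I})$ (finite $\mathcal{G}$, nonempty downward-closed $\mathcal{I}$) such that for all $A,B\in\mathcal{I}$ there is a collection $\{Y_e\subseteq B\setminus A:e\in A\setminus B\}$ with $|Y_e|\le k$, each $x\in B\setminus A$ in at most $k$ sets $Y_e$, and $(B\setminus\bigcup_{e\in C}Y_e)\cup C\in\mathcal{I}$ for all $C\subseteq A\setminus B$. For current solution $S$, a $k$-replacement is a pair $(A,B)$ with $B\subseteq S$, $A\subseteq\mathcal{G}\setminus(S\setminus B)$, $|A|\le k$, $|B|\le k^2-k+1$, $(S\setminus B)\cup A\in\mathcal{I}$. Weight function of a set $X$ w.r.t. an order $\prec$: list $X=\{x_1,\dots,x_m\}$ in $\prec$-order, $X_i=\{x_1,\dots,x_i\}$, and $w(x_i)=\lfloor (f(X_{i-1}\cup\{x_i\})-f(X_{i-1}))/\alpha\rfloor\alpha$. For a $k$-replacement $(A,B)$ of $S$: list $A=\{a_1,\dots,a_r\}$ in $\prec$-order, $A_i=\{a_1,\dots,a_i\}$, and $w_{(A,B)}(a_i)=\lfloor (f((S\setminus B)\cup A_{i-1}\cup\{a_i\})-f((S\setminus B)\cup A_{i-1}))/\alpha\rfloor\alpha$. -}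

module Defs where

open import Level using (0ℓ)
open import Data.Nat as ℕ using (ℕ; zero; suc)
open import Data.Integer as ℤ using (ℤ; +_; -[1+_])
open import Data.Bool using (Bool; true; false; _∧_; _∨_; if_then_else_)
open import Data.Fin using (Fin; toℕ) renaming (zero to fz; suc to fs)
open import Data.Fin.Subset using (Subset; _∈_; _⊆_; _∪_; _∩_; _─_; ∣_∣; ⊥)
open import Data.Fin.Permutation using (Permutation′; _⟨$⟩ʳ_)
open import Data.Vec using (lookup; tabulate)
open import Data.Product using (Σ; _×_; _,_)
open import Relation.Binary.PropositionalEquality using (_≡_; _≢_)
open import Relation.Binary.Structures using (IsTotalOrder)
open import Algebra.Structures using (IsCommutativeRing)
open import Function using (_∘_)
open import Data.Empty renaming (⊥ to Empty)

-- The value domain: an ordered field with a floor function.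
-- The real numbers are an instance; the lemma is stated for every such
-- structure.

fromℕ′ : {A : Set} → (A → A → A) → A → A → ℕ → A
fromℕ′ _+_ 0# 1# zero    = 0#
fromℕ′ _+_ 0# 1# (suc n) = fromℕ′ _+_ 0# 1# n + 1#

fromℤ′ : {A : Set} → (A → A → A) → (A → A) → A → A → ℤ → A
fromℤ′ _+_ -_ 0# 1# (+ n)    = fromℕ′ _+_ 0# 1# n
fromℤ′ _+_ -_ 0# 1# -[1+ n ] = - (fromℕ′ _+_ 0# 1# (suc n))

record OrderedFieldWithFloor : Set₁ where
  infixl 6 _+_
  infixl 7 _*_
  infix  8 -_
  infix  4 _≤_ _<_
  field
    Carrier : Set
    _+_ _*_ : Carrier → Carrier → Carrier
    -_      : Carrier → Carrier
    0# 1#   : Carrier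
    isCommutativeRing : IsCommutativeRing _≡_ _+_ _*_ -_ 0# 1#
    _≤_     : Carrier → Carrier → Set
    isTotalOrder : IsTotalOrder _≡_ _≤_
    +-mono-≤ : ∀ {x y} z → x ≤ y → x + z ≤ y + z
    *-nonneg : ∀ {x y} → 0# ≤ x → 0# ≤ y → 0# ≤ x * y
    0≢1     : 0# ≢ 1#
    _⁻¹     : Carrier → Carrier
    ⁻¹-inverse : ∀ x → x ≢ 0# → x * (x ⁻¹) ≡ 1#

  field
    ⌊_⌋ : Carrier → ℤ
    floor-lower : ∀ x → fromℤ′ _+_ -_ 0# 1# ⌊ x ⌋ ≤ x
    floor-upper : ∀ x → (x ≤ fromℤ′ _+_ -_ 0# 1# ⌊ x ⌋ + 1#)
                      × (x ≢ fromℤ′ _+_ -_ 0# 1# ⌊ x ⌋ + 1#)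

  _<_ : Carrier → Carrier → Set
  x < y = (x ≤ y) × (x ≢ y)

  _-_ : Carrier → Carrier → Carrier
  x - y = x + (- y)

  fromℤ : ℤ → Carrier
  fromℤ = fromℤ′ _+_ -_ 0# 1#

  _² : Carrier → Carrier
  x ² = x * x

anyFin : ∀ {n} → (Fin n → Bool) → Bool
anyFin {zero}  g = false
anyFin {suc n} g = g fz ∨ anyFin (g ∘ fs)

fromPred : ∀ {n} → (Fin n → Bool) → Subset n
fromPred g = tabulate g

⋃over : ∀ {n} → Subset n → (Fin n → Subset n) → Subset n
⋃over C Y = fromPred (λ x → anyFin (λ e → lookup C e ∧ lookup (Y e) x))

record IsIndependenceSystem {n : ℕ} (ℐ : Subset n → Set) : Set where
  field
    nonempty      : Σ (Subset n) ℐ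
    downwardClosed : ∀ {X Y} → X ⊆ Y → ℐ Y → ℐ X

record IsKExchangeSystem (k : ℕ) {n : ℕ} (ℐ : Subset n → Set) : Set where
  field
    isIndependenceSystem : IsIndependenceSystem ℐ
    exchange : ∀ A B → ℐ A → ℐ B →
      Σ (Fin n → Subset n) λ Y →
        (∀ e → e ∈ (A ─ B) → Y e ⊆ (B ─ A)) ×
        (∀ e → e ∈ (A ─ B) → ∣ Y e ∣ ℕ.≤ k) ×
        (∀ x → x ∈ (B ─ A) →
           ∣ fromPred (λ e → lookup (A ─ B) e ∧ lookup (Y e) x) ∣ ℕ.≤ k) ×
        (∀ C → C ⊆ (A ─ B) → ℐ ((B ─ ⋃over C Y) ∪ C))

Order : ℕ → Set
Order n = Permutation′ n

_≺⟨_⟩_ : ∀ {n} → Fin n → Order n → Fin n → Set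
x ≺⟨ π ⟩ y = toℕ (π ⟨$⟩ʳ x) ℕ.< toℕ (π ⟨$⟩ʳ y)

precB : ∀ {n} → Order n → Fin n → Fin n → Bool
precB π x y = toℕ (π ⟨$⟩ʳ x) ℕ.<ᵇ toℕ (π ⟨$⟩ʳ y)

before : ∀ {n} → Order n → Subset n → Fin n → Subset n
before π X x = fromPred (λ y → lookup X y ∧ precB π y x)

module _ (F : OrderedFieldWithFloor) where
  open OrderedFieldWithFloor F

  sumOver : ∀ {n} → Subset n → (Fin n → Carrier) → Carrier
  sumOver {zero}  X g = 0#
  sumOver {suc n} X g =
    (if lookup X fz then g fz else 0#) + sumOver (Data.Vec.tail X) (g ∘ fs)
    where import Data.Vec

  round : Carrier → Carrier → Carrier
  round α v = fromℤ ⌊ v * (α ⁻¹) ⌋ * α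

  record IsMonotoneSubmodular {n : ℕ} (f : Subset n → Carrier) : Set where
    field
      nonneg     : ∀ X → 0# ≤ f X
      monotone   : ∀ {X Y} → X ⊆ Y → f X ≤ f Y
      submodular : ∀ X Y → f (X ∪ Y) + f (X ∩ Y) ≤ f X + f Y

  weight : ∀ {n} → (Subset n → Carrier) → Carrier → Order n → Subset n →
           Fin n → Carrier
  weight f α π X x =
    round α (f (before π X x ∪ Data.Fin.Subset.⁅ x ⁆) - f (before π X x))
    where import Data.Fin.Subset

  replWeight : ∀ {n} → (Subset n → Carrier) → Carrier → Order n →
               (S A B : Subset n) → Fin n → Carrier
  replWeight f α π S A B a =
    round α (f ((S ─ B) ∪ before π A a ∪ Data.Fin.Subset.⁅ a ⁆)
             - f ((S ─ B) ∪ before π A a))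
    where import Data.Fin.Subset

record IsKReplacement (k : ℕ) {n : ℕ} (ℐ : Subset n → Set)
                      (S A B : Subset n) : Set where
  field
    B⊆S   : B ⊆ S
    A⊆G∖[S∖B] : ∀ x → x ∈ A → x ∈ (S ─ B) → Empty
    ∣A∣≤k : ∣ A ∣ ℕ.≤ k
    ∣B∣≤  : ∣ B ∣ ℕ.≤ k ℕ.* k ℕ.∸ k ℕ.+ 1
    indep : ℐ ((S ─ B) ∪ A)

-- Submodularity makes the marginal gain f (X ∪ {x}) − f X antitone in X, and rounding
-- down to a multiple of α > 0 and squaring preserve this, since gains are nonnegative by
-- monotonicity. Under ≺_T an element t of S ∖ B is preceded only by elements of S that
-- precede it under ≺, so w_T(t) ≥ w_S(t); an element a of A is preceded only by elements
-- of (S ∖ B) ∪ A_{<a}, so w_T(a) ≥ w_(A,B)(a). Hence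
--   Σ_S w_S² + γ = Σ_{S∖B} w_S² + (Σ_B w_S² + γ)
--                ≤ Σ_{S∖B} w_T² + Σ_A w_(A,B)² ≤ Σ_T w_T².
module Submission where

open import Defs
open import Level using (0ℓ)
open import Data.Nat as ℕ using (ℕ; suc)
import Data.Nat.Properties as ℕ
open import Data.Integer as ℤ using (-[1+_])
import Data.Integer.Properties as ℤ
open import Data.Bool using (Bool; true; false; T)
open import Data.Bool.Properties using (T-≡; T-∧)
open import Data.Product using (_×_; _,_; proj₁; proj₂)
open import Data.Sum using (inj₁; inj₂)
open import Data.Empty using (⊥-elim) renaming (⊥ to Empty)
open import Data.Fin as Fin using (Fin) renaming (zero to fz)
open import Data.Fin.Subset using (Subset; _∈_; _∉_; _⊆_; _∪_; _∩_; _─_; ⁅_⁆)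
open import Data.Fin.Subset.Properties
  using (x∈p∪q⁻; x∈p∩q⁺; p⊆p∪q; q⊆p∪q; p─q⊆p; drop-there; ∪-assoc)
open import Data.Vec.Base using (_∷_; []; here; there)
open import Data.Vec.Properties using ([]=⇒lookup; lookup⇒[]=; lookup∘tabulate)
open import Function using (_∘_; Equivalence)
open import Relation.Nullary using (¬_; yes; no)
open import Relation.Binary.PropositionalEquality using (_≡_; refl; sym; trans; cong)
open import Relation.Binary.Bundles using (Poset)
open import Relation.Binary.Structures using (IsTotalOrder)
open import Algebra.Bundles using (CommutativeRing)

commutativeRing : OrderedFieldWithFloor → CommutativeRing 0ℓ 0ℓ
commutativeRing F = record { isCommutativeRing = OrderedFieldWithFloor.isCommutativeRing F }

poset : OrderedFieldWithFloor → Poset 0ℓ 0ℓ 0ℓ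
poset F = record
  { isPartialOrder = IsTotalOrder.isPartialOrder (OrderedFieldWithFloor.isTotalOrder F) }

-- _-_ has no fixity declaration, so it binds tighter than _+_ and _*_: y - x + x is (y - x) + x.
module OrderedFieldWithFloorProperties (F : OrderedFieldWithFloor) where

  open OrderedFieldWithFloor F renaming (+-mono-≤ to +-monoˡ-≤)
  open CommutativeRing (commutativeRing F)
    using (+-comm; +-identityˡ; +-identityʳ; -‿inverseʳ; *-comm; *-assoc; *-identityˡ; ring)
  open import Algebra.Properties.Ring ring
    using (-0#≈0#; -‿involutive; -‿distribˡ-*; -‿distribʳ-*; [y-z]x≈yx-zx;
           //-rightDividesˡ; //-rightDividesʳ; -‿+-comm)
  open import Algebra.Properties.CommutativeSemigroup
    (CommutativeRing.+-commutativeSemigroup (commutativeRing F)) using (xy∙z≈xz∙y)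
  open IsTotalOrder isTotalOrder using (total; antisym)
  open IsTotalOrder isTotalOrder public using () renaming (refl to ≤-refl; trans to ≤-trans)
  open import Relation.Binary.Reasoning.PartialOrder (poset F)

  +-monoʳ-≤ : ∀ z {x y} → x ≤ y → z + x ≤ z + y
  +-monoʳ-≤ z {x} {y} x≤y = begin
    z + x  ≡⟨ +-comm z x ⟩
    x + z  ≤⟨ +-monoˡ-≤ z x≤y ⟩
    y + z  ≡⟨ +-comm y z ⟩
    z + y  ∎

  +-mono-≤ : ∀ {a b c d} → a ≤ b → c ≤ d → a + c ≤ b + d
  +-mono-≤ {b = b} {c = c} a≤b c≤d = ≤-trans (+-monoˡ-≤ c a≤b) (+-monoʳ-≤ b c≤d)

  x≤y⇒0≤y-x : ∀ {x y} → x ≤ y → 0# ≤ y - x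
  x≤y⇒0≤y-x {x} {y} x≤y = begin
    0#     ≡⟨ -‿inverseʳ x ⟨
    x - x  ≤⟨ +-monoˡ-≤ (- x) x≤y ⟩
    y - x  ∎

  0≤y-x⇒x≤y : ∀ {x y} → 0# ≤ y - x → x ≤ y
  0≤y-x⇒x≤y {x} {y} 0≤y-x = begin
    x          ≡⟨ +-identityˡ x ⟨
    0# + x     ≤⟨ +-monoˡ-≤ x 0≤y-x ⟩
    y - x + x  ≡⟨ //-rightDividesˡ x y ⟩
    y          ∎

  x+y≤z+w⇒x-w≤z-y : ∀ {x y z w} → x + y ≤ z + w → x - w ≤ z - y
  x+y≤z+w⇒x-w≤z-y {x} {y} {z} {w} x+y≤z+w = begin
    x - w              ≡⟨ cong (_- w) (//-rightDividesʳ y x) ⟨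
    ((x + y) - y) - w  ≤⟨ +-monoˡ-≤ (- w) (+-monoˡ-≤ (- y) x+y≤z+w) ⟩
    ((z + w) - y) - w  ≡⟨ cong (_- w) (xy∙z≈xz∙y z w (- y)) ⟩
    ((z - y) + w) - w  ≡⟨ //-rightDividesʳ w (z - y) ⟩
    z - y              ∎

  -‿antitone : ∀ {x y} → x ≤ y → - y ≤ - x
  -‿antitone {x} {y} x≤y = 0≤y-x⇒x≤y (begin
    0#             ≤⟨ x≤y⇒0≤y-x x≤y ⟩
    y - x          ≡⟨ +-comm y (- x) ⟩
    - x + y        ≡⟨ cong ((- x) +_) (-‿involutive y) ⟨
    (- x) - (- y)  ∎)

  x≤0⇒0≤-x : ∀ {x} → x ≤ 0# → 0# ≤ - x
  x≤0⇒0≤-x {x} x≤0 = begin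
    0#    ≡⟨ -0#≈0# ⟨
    - 0#  ≤⟨ -‿antitone x≤0 ⟩
    - x   ∎

  0≤x⇒-x≤0 : ∀ {x} → 0# ≤ x → - x ≤ 0#
  0≤x⇒-x≤0 {x} 0≤x = begin
    - x   ≤⟨ -‿antitone 0≤x ⟩
    - 0#  ≡⟨ -0#≈0# ⟩
    0#    ∎

  x²-nonneg : ∀ x → 0# ≤ x ²
  x²-nonneg x with total 0# x
  ... | inj₁ 0≤x = *-nonneg 0≤x 0≤x
  ... | inj₂ x≤0 = begin
    0#             ≤⟨ *-nonneg (x≤0⇒0≤-x x≤0) (x≤0⇒0≤-x x≤0) ⟩
    - x * - x      ≡⟨ -‿distribˡ-* x (- x) ⟨
    - (x * - x)    ≡⟨ cong -_ (-‿distribʳ-* x x) ⟨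
    - (- (x * x))  ≡⟨ -‿involutive (x * x) ⟩
    x * x          ∎

  0≤1 : 0# ≤ 1#
  0≤1 = begin
    0#       ≤⟨ x²-nonneg 1# ⟩
    1# * 1#  ≡⟨ *-identityˡ 1# ⟩
    1#       ∎

  0<x⇒0≤x⁻¹ : ∀ {x} → 0# < x → 0# ≤ x ⁻¹
  0<x⇒0≤x⁻¹ {x} (0≤x , 0≢x) = begin
    0#                  ≤⟨ *-nonneg 0≤x (x²-nonneg (x ⁻¹)) ⟩
    x * (x ⁻¹ * x ⁻¹)   ≡⟨ *-assoc x (x ⁻¹) (x ⁻¹) ⟨
    x * x ⁻¹ * x ⁻¹     ≡⟨ cong (_* x ⁻¹) (⁻¹-inverse x (0≢x ∘ sym)) ⟩
    1# * x ⁻¹           ≡⟨ *-identityˡ (x ⁻¹) ⟩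
    x ⁻¹                ∎

  *-monoˡ-≤-nonneg : ∀ {z x y} → 0# ≤ z → x ≤ y → x * z ≤ y * z
  *-monoˡ-≤-nonneg {z} {x} {y} 0≤z x≤y = 0≤y-x⇒x≤y (begin
    0#                 ≤⟨ *-nonneg (x≤y⇒0≤y-x x≤y) 0≤z ⟩
    (y - x) * z        ≡⟨ [y-z]x≈yx-zx z y x ⟩
    (y * z) - (x * z)  ∎)

  ²-mono-≤ : ∀ {x y} → 0# ≤ x → x ≤ y → x ² ≤ y ²
  ²-mono-≤ {x} {y} 0≤x x≤y = begin
    x * x  ≤⟨ *-monoˡ-≤-nonneg 0≤x x≤y ⟩
    y * x  ≡⟨ *-comm y x ⟩
    x * y  ≤⟨ *-monoˡ-≤-nonneg (≤-trans 0≤x x≤y) x≤y ⟩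
    y * y  ∎

  fromℕ : ℕ → Carrier
  fromℕ = fromℕ′ _+_ 0# 1#

  fromℕ-mono-≤′ : ∀ {m n} → m ℕ.≤′ n → fromℕ m ≤ fromℕ n
  fromℕ-mono-≤′ ℕ.≤′-refl = ≤-refl
  fromℕ-mono-≤′ {m} (ℕ.≤′-step {n} m≤′n) = begin
    fromℕ m        ≤⟨ fromℕ-mono-≤′ m≤′n ⟩
    fromℕ n        ≡⟨ +-identityʳ (fromℕ n) ⟨
    fromℕ n + 0#   ≤⟨ +-monoʳ-≤ (fromℕ n) 0≤1 ⟩
    fromℕ (suc n)  ∎

  fromℕ-mono-≤ : ∀ {m n} → m ℕ.≤ n → fromℕ m ≤ fromℕ n
  fromℕ-mono-≤ = fromℕ-mono-≤′ ∘ ℕ.≤⇒≤′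

  fromℕ-nonneg : ∀ n → 0# ≤ fromℕ n
  fromℕ-nonneg n = fromℕ-mono-≤ {n = n} ℕ.z≤n

  fromℤ-mono-≤ : ∀ {i j} → i ℤ.≤ j → fromℤ i ≤ fromℤ j
  fromℤ-mono-≤ (ℤ.-≤- n≤m) = -‿antitone (fromℕ-mono-≤ (ℕ.s≤s n≤m))
  fromℤ-mono-≤ { -[1+ m ]} {ℤ.+ n} ℤ.-≤+ =
    ≤-trans (0≤x⇒-x≤0 (fromℕ-nonneg (suc m))) (fromℕ-nonneg n)
  fromℤ-mono-≤ (ℤ.+≤+ m≤n) = fromℕ-mono-≤ m≤n

  -[x+1]+1≡-x : ∀ x → - (x + 1#) + 1# ≡ - x
  -[x+1]+1≡-x x = trans (cong (_+ 1#) (sym (-‿+-comm x 1#))) (//-rightDividesˡ 1# (- x))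

  fromℤ-<⇒+1≤ : ∀ {i j} → i ℤ.< j → fromℤ i + 1# ≤ fromℤ j
  fromℤ-<⇒+1≤ (ℤ.-<- {m} {n} n<m) = begin
    - (fromℕ m + 1#) + 1#  ≡⟨ -[x+1]+1≡-x (fromℕ m) ⟩
    - fromℕ m              ≤⟨ -‿antitone (fromℕ-mono-≤ n<m) ⟩
    - fromℕ (suc n)        ∎
  fromℤ-<⇒+1≤ { -[1+ m ]} {ℤ.+ n} ℤ.-<+ = begin
    - (fromℕ m + 1#) + 1#  ≡⟨ -[x+1]+1≡-x (fromℕ m) ⟩
    - fromℕ m              ≤⟨ 0≤x⇒-x≤0 (fromℕ-nonneg m) ⟩
    0#                     ≤⟨ fromℕ-nonneg n ⟩
    fromℕ n                ∎
  fromℤ-<⇒+1≤ (ℤ.+<+ m<n) = fromℕ-mono-≤ m<n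

  ⌊⌋-greatest : ∀ i x → fromℤ i ≤ x → i ℤ.≤ ⌊ x ⌋
  ⌊⌋-greatest i x i≤x with i ℤ.≤? ⌊ x ⌋
  ... | yes i≤⌊x⌋ = i≤⌊x⌋
  -- Otherwise ⌊ x ⌋ + 1 ≤ i ≤ x, contradicting x < ⌊ x ⌋ + 1.
  ... | no i≰⌊x⌋  = ⊥-elim (proj₂ (floor-upper x) (antisym (proj₁ (floor-upper x))
                      (≤-trans (fromℤ-<⇒+1≤ (ℤ.≰⇒> i≰⌊x⌋)) i≤x)))

  ⌊⌋-mono-≤ : ∀ {x y} → x ≤ y → ⌊ x ⌋ ℤ.≤ ⌊ y ⌋
  ⌊⌋-mono-≤ {x} {y} x≤y = ⌊⌋-greatest ⌊ x ⌋ y (≤-trans (floor-lower x) x≤y)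

  round-nonneg : ∀ {α u} → 0# < α → 0# ≤ u → 0# ≤ round F α u
  round-nonneg 0<α 0≤u = *-nonneg
    (fromℤ-mono-≤ (⌊⌋-greatest (ℤ.+ 0) _ (*-nonneg 0≤u (0<x⇒0≤x⁻¹ 0<α)))) (proj₁ 0<α)

  round-mono-≤ : ∀ {α u v} → 0# < α → u ≤ v → round F α u ≤ round F α v
  round-mono-≤ 0<α u≤v = *-monoˡ-≤-nonneg (proj₁ 0<α)
    (fromℤ-mono-≤ (⌊⌋-mono-≤ (*-monoˡ-≤-nonneg (0<x⇒0≤x⁻¹ 0<α) u≤v)))

module SumOverProperties (F : OrderedFieldWithFloor) where

  open OrderedFieldWithFloor F renaming (+-mono-≤ to +-monoˡ-≤)
  open OrderedFieldWithFloorProperties F using (≤-refl; +-monoʳ-≤; +-mono-≤)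
  open CommutativeRing (commutativeRing F)
    using (+-identityˡ; +-identityʳ; +-commutativeSemigroup)
  open import Algebra.Properties.CommutativeSemigroup +-commutativeSemigroup
    using (interchange)

  private
    +-interchange-≡ : ∀ {u v w a b c} → u ≡ v + w → a ≡ b + c → u + a ≡ (v + b) + (w + c)
    +-interchange-≡ refl refl = interchange _ _ _ _

    ∷-disjoint : ∀ {n x y} {X Y : Subset n} →
      (∀ {i} → i ∈ x ∷ X → i ∉ y ∷ Y) → (∀ {i} → i ∈ X → i ∉ Y)
    ∷-disjoint disjoint i∈X i∈Y = disjoint (there i∈X) (there i∈Y)

  sumOver-mono-≤ : ∀ {n} (X : Subset n) {g h : Fin n → Carrier} →
    (∀ {i} → i ∈ X → g i ≤ h i) → sumOver F X g ≤ sumOver F X h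
  sumOver-mono-≤ []          g≤h = ≤-refl
  sumOver-mono-≤ (true ∷ X)  g≤h = +-mono-≤ (g≤h here) (sumOver-mono-≤ X (g≤h ∘ there))
  sumOver-mono-≤ (false ∷ X) g≤h = +-monoʳ-≤ 0# (sumOver-mono-≤ X (g≤h ∘ there))

  sumOver-∪ : ∀ {n} (X Y : Subset n) (g : Fin n → Carrier) → (∀ {i} → i ∈ X → i ∉ Y) →
    sumOver F (X ∪ Y) g ≡ sumOver F X g + sumOver F Y g
  sumOver-∪ [] [] g _ = sym (+-identityˡ 0#)
  sumOver-∪ (true ∷ X) (true ∷ Y) g disjoint = ⊥-elim (disjoint here here)
  sumOver-∪ (true ∷ X) (false ∷ Y) g disjoint =
    +-interchange-≡ (sym (+-identityʳ (g fz)))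
      (sumOver-∪ X Y (g ∘ Fin.suc) (∷-disjoint disjoint))
  sumOver-∪ (false ∷ X) (y ∷ Y) g disjoint =
    +-interchange-≡ (sym (+-identityˡ _))
      (sumOver-∪ X Y (g ∘ Fin.suc) (∷-disjoint disjoint))

  sumOver-─ : ∀ {n} (S B : Subset n) (g : Fin n → Carrier) → B ⊆ S →
    sumOver F S g ≡ sumOver F (S ─ B) g + sumOver F B g
  sumOver-─ [] [] g _ = sym (+-identityˡ 0#)
  sumOver-─ (x ∷ S) (true ∷ B) g B⊆S with B⊆S here
  ... | here = +-interchange-≡ (sym (+-identityˡ (g fz)))
                 (sumOver-─ S B (g ∘ Fin.suc) (drop-there ∘ B⊆S ∘ there))
  sumOver-─ (x ∷ S) (false ∷ B) g B⊆S =
    +-interchange-≡ (sym (+-identityʳ _))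
      (sumOver-─ S B (g ∘ Fin.suc) (drop-there ∘ B⊆S ∘ there))

∈-fromPred⁻ : ∀ {n} {g : Fin n → Bool} {x} → x ∈ fromPred g → T (g x)
∈-fromPred⁻ {g = g} {x} x∈g =
  Equivalence.from T-≡ (trans (sym (lookup∘tabulate g x)) ([]=⇒lookup x∈g))

∈-fromPred⁺ : ∀ {n} {g : Fin n → Bool} {x} → T (g x) → x ∈ fromPred g
∈-fromPred⁺ {g = g} {x} gx =
  lookup⇒[]= x _ (trans (lookup∘tabulate g x) (Equivalence.to T-≡ gx))

∈-before⁻ : ∀ {n} (π : Order n) {X x y} → y ∈ before π X x → y ∈ X × y ≺⟨ π ⟩ x
∈-before⁻ π {X} {x} {y} y∈ =
  let y∈X , y≺x = Equivalence.to T-∧ (∈-fromPred⁻ y∈)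
  in lookup⇒[]= y X (Equivalence.to T-≡ y∈X) , ℕ.<ᵇ⇒< _ _ y≺x

∈-before⁺ : ∀ {n} (π : Order n) {X x y} → y ∈ X → y ≺⟨ π ⟩ x → y ∈ before π X x
∈-before⁺ π y∈X y≺x =
  ∈-fromPred⁺ (Equivalence.from T-∧ (Equivalence.from T-≡ ([]=⇒lookup y∈X) , ℕ.<⇒<ᵇ y≺x))

before-mono : ∀ {n} (π : Order n) {X Y x} → X ⊆ Y → before π X x ⊆ before π Y x
before-mono π X⊆Y y∈ = let y∈X , y≺x = ∈-before⁻ π y∈ in ∈-before⁺ π (X⊆Y y∈X) y≺x

module MarginalGain (F : OrderedFieldWithFloor) {n : ℕ}
  (f : Subset n → OrderedFieldWithFloor.Carrier F) (f-submodular : IsMonotoneSubmodular F f) where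

  open OrderedFieldWithFloor F renaming (+-mono-≤ to +-monoˡ-≤)
  open OrderedFieldWithFloorProperties F
  open IsMonotoneSubmodular f-submodular
  open import Relation.Binary.Reasoning.PartialOrder (poset F)

  marginalGain : Subset n → Subset n → Carrier
  marginalGain X Z = f (X ∪ Z) - f X

  marginalGain-nonneg : ∀ X Z → 0# ≤ marginalGain X Z
  marginalGain-nonneg X Z = x≤y⇒0≤y-x (monotone (p⊆p∪q Z))

  marginalGain-antitone : ∀ {X Y} Z → X ⊆ Y → marginalGain Y Z ≤ marginalGain X Z
  marginalGain-antitone {X} {Y} Z X⊆Y = x+y≤z+w⇒x-w≤z-y (begin
    f (Y ∪ Z) + f X
      ≤⟨ +-mono-≤ (monotone Y∪Z⊆X∪Z∪Y) (monotone X⊆[X∪Z]∩Y) ⟩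
    f ((X ∪ Z) ∪ Y) + f ((X ∪ Z) ∩ Y)
      ≤⟨ submodular (X ∪ Z) Y ⟩
    f (X ∪ Z) + f Y
    ∎)
    where
    Y∪Z⊆X∪Z∪Y : Y ∪ Z ⊆ (X ∪ Z) ∪ Y
    Y∪Z⊆X∪Z∪Y x∈Y∪Z with x∈p∪q⁻ Y Z x∈Y∪Z
    ... | inj₁ x∈Y = q⊆p∪q (X ∪ Z) Y x∈Y
    ... | inj₂ x∈Z = p⊆p∪q Y (q⊆p∪q X Z x∈Z)

    X⊆[X∪Z]∩Y : X ⊆ (X ∪ Z) ∩ Y
    X⊆[X∪Z]∩Y x∈X = x∈p∩q⁺ (p⊆p∪q Z x∈X , X⊆Y x∈X)

  roundedMarginalGain²-antitone : ∀ {α} → 0# < α → ∀ {X Y} Z → X ⊆ Y →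
    round F α (marginalGain Y Z) ² ≤ round F α (marginalGain X Z) ²
  roundedMarginalGain²-antitone 0<α {Y = Y} Z X⊆Y =
    ²-mono-≤ (round-nonneg 0<α (marginalGain-nonneg Y Z))
             (round-mono-≤ 0<α (marginalGain-antitone Z X⊆Y))

module Concatenation {n : ℕ} (π πT : Order n) (P Q : Subset n)
  (disjoint : ∀ x → x ∈ Q → x ∈ P → Empty)
  (P≺Q : ∀ x y → x ∈ P ∪ Q → y ∈ P ∪ Q → x ∈ P → y ∈ Q → x ≺⟨ πT ⟩ y)
  (sameBlock : ∀ x y → x ∈ P ∪ Q → y ∈ P ∪ Q → ¬ (x ∈ P × y ∈ Q) → ¬ (x ∈ Q × y ∈ P) →
               (x ≺⟨ πT ⟩ y → x ≺⟨ π ⟩ y) × (x ≺⟨ π ⟩ y → x ≺⟨ πT ⟩ y)) where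

  private
    ≺ᵀ⇒≺-in-P : ∀ {x y} → x ∈ P → y ∈ P → x ≺⟨ πT ⟩ y → x ≺⟨ π ⟩ y
    ≺ᵀ⇒≺-in-P {x} {y} x∈P y∈P = proj₁ (sameBlock x y (p⊆p∪q Q x∈P) (p⊆p∪q Q y∈P)
      (λ (_ , y∈Q) → disjoint y y∈Q y∈P) (λ (x∈Q , _) → disjoint x x∈Q x∈P))

    ≺ᵀ⇒≺-in-Q : ∀ {x y} → x ∈ Q → y ∈ Q → x ≺⟨ πT ⟩ y → x ≺⟨ π ⟩ y
    ≺ᵀ⇒≺-in-Q {x} {y} x∈Q y∈Q = proj₁ (sameBlock x y (q⊆p∪q P Q x∈Q) (q⊆p∪q P Q y∈Q)
      (λ (x∈P , _) → disjoint x x∈Q x∈P) (λ (_ , y∈P) → disjoint y y∈Q y∈P))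

  before-in-P : ∀ {x} → x ∈ P → before πT (P ∪ Q) x ⊆ before π P x
  before-in-P {x} x∈P {y} y∈ with ∈-before⁻ πT y∈
  ... | y∈P∪Q , y≺ᵀx with x∈p∪q⁻ P Q y∈P∪Q
  ... | inj₁ y∈P = ∈-before⁺ π y∈P (≺ᵀ⇒≺-in-P y∈P x∈P y≺ᵀx)
  ... | inj₂ y∈Q = ⊥-elim (ℕ.<-asym y≺ᵀx (P≺Q x y (p⊆p∪q Q x∈P) y∈P∪Q x∈P y∈Q))

  before-in-Q : ∀ {x} → x ∈ Q → before πT (P ∪ Q) x ⊆ P ∪ before π Q x
  before-in-Q {x} x∈Q {y} y∈ with ∈-before⁻ πT y∈
  ... | y∈P∪Q , y≺ᵀx with x∈p∪q⁻ P Q y∈P∪Q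
  ... | inj₁ y∈P = p⊆p∪q (before π Q x) y∈P
  ... | inj₂ y∈Q = q⊆p∪q P (before π Q x) (∈-before⁺ π y∈Q (≺ᵀ⇒≺-in-Q y∈Q x∈Q y≺ᵀx))

lemma5 : (k n : ℕ) (ℐ : Subset n → Set) → IsKExchangeSystem k ℐ →
    (F : OrderedFieldWithFloor) →
    let open OrderedFieldWithFloor F in
    (f : Subset n → Carrier) → IsMonotoneSubmodular F f →
    (α : Carrier) → 0# < α →
    (S : Subset n) → ℐ S → (π : Order n) →
    (A B : Subset n) → IsKReplacement k ℐ S A B →
    (γ : Carrier) → 0# < γ →
    sumOver F B (λ b → weight F f α π S b ²) + γ
      ≤ sumOver F A (λ a → replWeight F f α π S A B a ²) →
    (πT : Order n) →
    (∀ x y → x ∈ (S ─ B) ∪ A → y ∈ (S ─ B) ∪ A →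
       x ∈ S ─ B → y ∈ A → x ≺⟨ πT ⟩ y) →
    (∀ x y → x ∈ (S ─ B) ∪ A → y ∈ (S ─ B) ∪ A →
       ¬ (x ∈ S ─ B × y ∈ A) → ¬ (x ∈ A × y ∈ S ─ B) →
       (x ≺⟨ πT ⟩ y → x ≺⟨ π ⟩ y) × (x ≺⟨ π ⟩ y → x ≺⟨ πT ⟩ y)) →
    sumOver F S (λ s → weight F f α π S s ²) + γ
      ≤ sumOver F ((S ─ B) ∪ A) (λ t → weight F f α πT ((S ─ B) ∪ A) t ²)
lemma5 k n ℐ _ F f f-submodular α 0<α S _ π A B replacement γ _ swap-gain πT S∖B≺A sameBlock =
  begin
    sumOver F S wS + γ
      ≡⟨ cong (_+ γ) (sumOver-─ S B wS B⊆S) ⟩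
    (sumOver F (S ─ B) wS + sumOver F B wS) + γ
      ≡⟨ +-assoc _ _ γ ⟩
    sumOver F (S ─ B) wS + (sumOver F B wS + γ)
      ≤⟨ +-mono-≤ (sumOver-mono-≤ (S ─ B) kept-weight-≤) swap-gain ⟩
    sumOver F (S ─ B) wT + sumOver F A wR
      ≤⟨ +-monoʳ-≤ _ (sumOver-mono-≤ A added-weight-≤) ⟩
    sumOver F (S ─ B) wT + sumOver F A wT
      ≡⟨ sumOver-∪ (S ─ B) A wT ∈S∖B⇒∉A ⟨
    sumOver F ((S ─ B) ∪ A) wT
  ∎
  where
  open OrderedFieldWithFloor F using (Carrier; _+_; _-_; _≤_; _²)
  open CommutativeRing (commutativeRing F) using (+-assoc)
  open OrderedFieldWithFloorProperties F using (+-mono-≤; +-monoʳ-≤)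
  open SumOverProperties F
  open MarginalGain F f f-submodular
  open IsKReplacement replacement
  open Concatenation π πT (S ─ B) A A⊆G∖[S∖B] S∖B≺A sameBlock
  open import Relation.Binary.Reasoning.PartialOrder (poset F)

  wS wT wR : Fin n → Carrier
  wS s = weight F f α π S s ²
  wT t = weight F f α πT ((S ─ B) ∪ A) t ²
  wR a = replWeight F f α π S A B a ²

  ∈S∖B⇒∉A : ∀ {x} → x ∈ S ─ B → x ∉ A
  ∈S∖B⇒∉A x∈S∖B x∈A = A⊆G∖[S∖B] _ x∈A x∈S∖B

  kept-weight-≤ : ∀ {t} → t ∈ S ─ B → wS t ≤ wT t
  kept-weight-≤ t∈S∖B = roundedMarginalGain²-antitone 0<α _
    (before-mono π (p─q⊆p S B) ∘ before-in-P t∈S∖B)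

  added-weight-≤ : ∀ {a} → a ∈ A → wR a ≤ wT a
  added-weight-≤ {a} a∈A = begin
    wR a
      ≡⟨ cong (λ Y → round F α (f Y - f Sₐ) ²) (sym (∪-assoc (S ─ B) (before π A a) ⁅ a ⁆)) ⟩
    round F α (marginalGain Sₐ ⁅ a ⁆) ²
      ≤⟨ roundedMarginalGain²-antitone 0<α ⁅ a ⁆ (before-in-Q a∈A) ⟩
    wT a
    ∎
    where
    Sₐ : Subset n
    Sₐ = (S ─ B) ∪ before π A a
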